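{- For every $k\in\mathbb{N}$, \[ N_{\mathrm{FO}_k}\le \mathrm{twr}\bigl(k+\log^*(k^2+k)+1\bigr)\quad\text{and}\quad N_{\mathrm{MSO}_k}\le \mathrm{twr}\bigl(k+\log^*((k+1)^2)+1\bigr). \]
   Context: Words are nonempty finite words over the alphabet $\Sigma=\{l,r\}$; a word is identified with its word model: the finite structure whose domain is the set of positions, with the linear order $<$ and unary predicates $P_l,P_r$ marking the positions carrying $l$ and $r$. All formulas of first-order logic FO and monadic second-order logic MSO are over the vocabulary $\{<,P_l,P_r\}$. The quantifier rank $\mathrm{qr}$ is defined by: $\mathrm{qr}=0$ for atomic formulas, $\mathrm{qr}(\neg\psi)=\mathrm{qr}(\psi)$, $\mathrm{qr}(\psi\wedge\theta)=\mathrm{qr}(\psi\vee\theta)=\max(\mathrm{qr}(\psi),\mathrm{qr}(\theta))$, and each first- or second-order quantifier adds $1$. $\mathrm{FO}_k$ (resp. $\mathrm{MSO}_k$) is the set of FO (resp. MSO) formulas of quantifier rank at most $k$. For a fragment $L$, words $w,v$ satisfy $w\equiv_L v$ if they satisfy the same $L$-sentences; $N_L$ denotes the number of $\equiv_L$-equivalence classes on $\Sigma$-words. $\mathrm{tower}(0)=1$, $\mathrm{tower}(n+1)=2^{\mathrm{tower}(n)}$; for real $x\ge 0$, $\mathrm{twr}(x)=\mathrm{tower}(\lceil x\rceil)$; for real $x\ge1$, $\log^*(x)$ is the least $m\in\mathbb{N}$ with $\mathrm{tower}(m)\ge x$. -}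

module Defs where

open import Data.Nat using (ℕ; zero; suc; _+_; _*_; _≤_; _≤ᵇ_; _⊔_)
open import Data.Bool using (Bool; true; false; if_then_else_)
open import Data.Fin using (Fin)
import Data.Fin as F
open import Data.Fin.Subset using (Subset; _∈_)
open import Data.Vec using (Vec; []; _∷_; lookup)
open import Data.List using (List)
import Data.List as L
open import Data.List.NonEmpty using (List⁺; toList)
import Data.List.NonEmpty as L⁺
open import Data.List.Relation.Unary.AllPairs using (AllPairs)
open import Data.Product using (Σ; _×_)
open import Data.Sum using (_⊎_)
open import Relation.Nullary using (¬_)
open import Relation.Binary.PropositionalEquality using (_≡_)
open import Function.Bundles using (_⇔_)

tower : ℕ → ℕ
tower zero    = 1
tower (suc n) = 2 Data.Nat.^ tower n

-- log* x = least m with tower m ≥ x (search m = 0,1,2,...; fuel x suffices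
-- since tower m ≥ m).  For x = 0 this gives 0.
logStarFrom : ℕ → ℕ → ℕ → ℕ
logStarFrom x m zero       = m
logStarFrom x m (suc fuel) = if x ≤ᵇ tower m then m else logStarFrom x (suc m) fuel

logStar : ℕ → ℕ
logStar x = logStarFrom x 0 x

data Letter : Set where
  l r : Letter

Word : Set
Word = List⁺ Letter

len : Word → ℕ
len w = L⁺.length w

Pos : Word → Set
Pos w = Fin (len w)

letterAt : (w : Word) → Pos w → Letter
letterAt w i = L.lookup (toList w) i

-- Syntax of FO / MSO over {<, P_l, P_r} (with equality)
-- Form L n m : formulas of logic L with n free first-order variables and
-- m free set variables (de Bruijn indices).

data Logic : Set where
  FO MSO : Logic

data Form : Logic → ℕ → ℕ → Set where
  lt  : ∀ {L n m} → Fin n → Fin n → Form L n m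
  eq  : ∀ {L n m} → Fin n → Fin n → Form L n m
  Pl  : ∀ {L n m} → Fin n → Form L n m
  Pr  : ∀ {L n m} → Fin n → Form L n m
  mem : ∀ {n m} → Fin m → Fin n → Form MSO n m
  neg : ∀ {L n m} → Form L n m → Form L n m
  and : ∀ {L n m} → Form L n m → Form L n m → Form L n m
  or  : ∀ {L n m} → Form L n m → Form L n m → Form L n m
  ex  : ∀ {L n m} → Form L (suc n) m → Form L n m
  all : ∀ {L n m} → Form L (suc n) m → Form L n m
  ex₂  : ∀ {n m} → Form MSO n (suc m) → Form MSO n m
  all₂ : ∀ {n m} → Form MSO n (suc m) → Form MSO n m

qr : ∀ {L n m} → Form L n m → ℕ
qr (lt _ _)   = 0
qr (eq _ _)   = 0
qr (Pl _)     = 0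
qr (Pr _)     = 0
qr (mem _ _)  = 0
qr (neg φ)    = qr φ
qr (and φ ψ)  = qr φ ⊔ qr ψ
qr (or φ ψ)   = qr φ ⊔ qr ψ
qr (ex φ)     = suc (qr φ)
qr (all φ)    = suc (qr φ)
qr (ex₂ φ)    = suc (qr φ)
qr (all₂ φ)   = suc (qr φ)

Sat : ∀ {L n m} (w : Word) → Form L n m →
      Vec (Pos w) n → Vec (Subset (len w)) m → Set
Sat w (lt i j)  ρ σ = lookup ρ i F.< lookup ρ j
Sat w (eq i j)  ρ σ = lookup ρ i ≡ lookup ρ j
Sat w (Pl i)    ρ σ = letterAt w (lookup ρ i) ≡ l
Sat w (Pr i)    ρ σ = letterAt w (lookup ρ i) ≡ r
Sat w (mem X i) ρ σ = lookup ρ i ∈ lookup σ X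
Sat w (neg φ)   ρ σ = ¬ Sat w φ ρ σ
Sat w (and φ ψ) ρ σ = Sat w φ ρ σ × Sat w ψ ρ σ
Sat w (or φ ψ)  ρ σ = Sat w φ ρ σ ⊎ Sat w ψ ρ σ
Sat w (ex φ)    ρ σ = Σ (Pos w) λ p → Sat w φ (p ∷ ρ) σ
Sat w (all φ)   ρ σ = (p : Pos w) → Sat w φ (p ∷ ρ) σ
Sat w (ex₂ φ)   ρ σ = Σ (Subset (len w)) λ X → Sat w φ ρ (X ∷ σ)
Sat w (all₂ φ)  ρ σ = (X : Subset (len w)) → Sat w φ ρ (X ∷ σ)

_⊨_ : ∀ {L} → Word → Form L 0 0 → Set
w ⊨ φ = Sat w φ [] []

Equiv : Logic → ℕ → Word → Word → Set
Equiv L k w v = (φ : Form L 0 0) → qr φ ≤ k → (w ⊨ φ) ⇔ (v ⊨ φ)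

-- N_{L_k} ≤ B : every list of pairwise ≡_{L_k}-inequivalent words has
-- length at most B (i.e. there are at most B equivalence classes).
NumClasses≤ : Logic → ℕ → ℕ → Set
NumClasses≤ L k B =
  (ws : List Word) → AllPairs (λ w v → ¬ Equiv L k w v) ws → L.length ws ≤ B

-- Hintikka types.  The rank-j type of a word with n assigned positions and m assigned sets is
-- defined by recursion on j: at rank 0 it records the atomic facts (order and letters of the
-- positions, memberships in the sets); at rank j+1 it records which rank-j types are realised by
-- extending the assignment by one position (and, for MSO, by one set).  Equal rank-k types give
-- equal truth values for all formulas of quantifier rank ≤ k, so N_{L_k} is at most the number
-- of rank-k types of the empty assignment.  That number is a tower: for FO it is 2^(n²+n) at
-- rank 0 and 2^(count at rank j with n+1 variables) at rank j+1, so with k² + k ≤ tower T it is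
-- at most tower (k + T + 1), and T = log*(k² + k) is admissible.  For MSO the exponent at rank
-- j+1 is a sum of two counts; bounding four times the count absorbs that sum, at the price of
-- needing k² + k + 2 ≤ tower T, which (k + 1)² ≤ tower T gives for k ≥ 1.
module Submission where

open import Defs
open import Data.Bool using (true; false; T)
open import Data.Empty using (⊥-elim)
open import Data.Fin as Fin using (Fin; zero; suc; combine; funToFin; finToFun)
open import Data.Fin.Properties
  using (any?; pigeonhole; combine-injectiveˡ; combine-injectiveʳ; finToFun-funToFin)
  renaming (_≟_ to _≟ᶠ_; _<?_ to _<ᶠ?_; <-cmp to <ᶠ-cmp; <-irrefl to <ᶠ-irrefl)
open import Data.Fin.Subset using (Subset; _∈_)
open import Data.Fin.Subset.Properties using (anySubset?; _∈?_)
open import Data.List as List using (List)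
open import Data.List.Membership.Propositional.Properties using (∈-lookup)
open import Data.List.NonEmpty using (_∷_)
import Data.List.Relation.Unary.All as All
open import Data.List.Relation.Unary.AllPairs using (AllPairs; _∷_)
open import Data.Nat
open import Data.Nat.Properties
open import Data.Nat.Tactic.RingSolver using (solve-∀)
open import Data.Product using (∃; _×_; _,_; proj₂; map₂)
open import Data.Sum using (inj₁; inj₂)
open import Data.Unit using (tt)
open import Data.Vec using (Vec; []; _∷_; lookup)
open import Function using (_∘_)
open import Function.Bundles using (mk⇔)
open import Relation.Binary using (tri<; tri≈; tri>)
open import Relation.Binary.PropositionalEquality
open import Relation.Nullary using (Dec; yes; no)
open import Relation.Unary using (Decidable)

private
  variable
    A B : Set
    P Q : Set
    L : Logic
    j k n m b : ℕ

⌊_⌋₂ : Dec P → Fin 2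
⌊ yes _ ⌋₂ = suc zero
⌊ no _ ⌋₂ = zero

⌊⌋₂-≡⇒→ : (P? : Dec P) (Q? : Dec Q) → ⌊ P? ⌋₂ ≡ ⌊ Q? ⌋₂ → P → Q
⌊⌋₂-≡⇒→ (yes _) (yes q) _ _ = q
⌊⌋₂-≡⇒→ (no ¬p) _ _ p = ⊥-elim (¬p p)

funToFin-injective : {f g : Fin n → Fin m} → funToFin f ≡ funToFin g → ∀ i → f i ≡ g i
funToFin-injective {f = f} {g} e i = begin
  f i                       ≡⟨ finToFun-funToFin f i ⟨
  finToFun (funToFin f) i   ≡⟨ cong (λ c → finToFun c i) e ⟩
  finToFun (funToFin g) i   ≡⟨ finToFun-funToFin g i ⟩
  g i                       ∎
  where open ≡-Reasoning

Searchable : Set → Set₁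
Searchable A = ∀ {P : A → Set} → Decidable P → Dec (∃ P)

-- The image of f, coded by its characteristic function on Fin b.
image : Searchable A → (A → Fin b) → Fin (2 ^ b)
image search f = funToFin λ t → ⌊ search (λ x → f x ≟ᶠ t) ⌋₂

image-≡⇒⊆ : (searchA : Searchable A) (searchB : Searchable B) {f : A → Fin b} {g : B → Fin b} →
            image searchA f ≡ image searchB g → ∀ x → ∃ λ y → f x ≡ g y
image-≡⇒⊆ searchA searchB {f} {g} e x =
  map₂ sym (⌊⌋₂-≡⇒→ (searchA (λ x′ → f x′ ≟ᶠ f x)) (searchB (λ y → g y ≟ᶠ f x))
                    (funToFin-injective e (f x)) (x , refl))

is-l? : (a : Letter) → Dec (a ≡ l)
is-l? l = yes refl
is-l? r = no λ ()

≢l⇒≡r : {a : Letter} → a ≢ l → a ≡ r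
≢l⇒≡r {l} a≢l = ⊥-elim (a≢l refl)
≢l⇒≡r {r} _   = refl

firstPos : (w : Word) → Pos w
firstPos (_ ∷ _) = zero

orderTable : (w : Word) → Vec (Pos w) n → Fin ((2 ^ n) ^ n)
orderTable w ρ = funToFin λ i → funToFin λ k → ⌊ lookup ρ i <ᶠ? lookup ρ k ⌋₂

letterTable : (w : Word) → Vec (Pos w) n → Fin (2 ^ n)
letterTable w ρ = funToFin λ i → ⌊ is-l? (letterAt w (lookup ρ i)) ⌋₂

memberTable : (w : Word) → Vec (Pos w) n → Vec (Subset (len w)) m → Fin ((2 ^ n) ^ m)
memberTable w ρ σ = funToFin λ X → funToFin λ i → ⌊ lookup ρ i ∈? lookup σ X ⌋₂

typeCount : Logic → ℕ → ℕ → ℕ → ℕ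
typeCount FO  zero    n m = (2 ^ n) ^ n * 2 ^ n
typeCount MSO zero    n m = (2 ^ n) ^ n * 2 ^ n * (2 ^ n) ^ m
typeCount FO  (suc j) n m = 2 ^ typeCount FO j (suc n) m
typeCount MSO (suc j) n m = 2 ^ typeCount MSO j (suc n) m * 2 ^ typeCount MSO j n (suc m)

type : ∀ L j (w : Word) → Vec (Pos w) n → Vec (Subset (len w)) m → Fin (typeCount L j n m)
type FO  zero    w ρ σ = combine (orderTable w ρ) (letterTable w ρ)
type MSO zero    w ρ σ = combine (combine (orderTable w ρ) (letterTable w ρ)) (memberTable w ρ σ)
type FO  (suc j) w ρ σ = image any? λ p → type FO j w (p ∷ ρ) σ
type MSO (suc j) w ρ σ =
  combine (image any? λ p → type MSO j w (p ∷ ρ) σ) (image anySubset? λ X → type MSO j w ρ (X ∷ σ))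

record SameType (L : Logic) (j : ℕ)
                (w : Word) (ρ : Vec (Pos w) n) (σ : Vec (Subset (len w)) m)
                (v : Word) (ρ′ : Vec (Pos v) n) (σ′ : Vec (Subset (len v)) m) : Set where
  constructor sameType
  field type-≡ : type L j w ρ σ ≡ type L j v ρ′ σ′

module _ {n m : ℕ} {w v : Word} {ρ : Vec (Pos w) n} {σ : Vec (Subset (len w)) m}
         {ρ′ : Vec (Pos v) n} {σ′ : Vec (Subset (len v)) m} where

  SameType-sym : SameType L j w ρ σ v ρ′ σ′ → SameType L j v ρ′ σ′ w ρ σ
  SameType-sym (sameType e) = sameType (sym e)

  SameType₀⇒< : SameType L zero w ρ σ v ρ′ σ′ →
                ∀ i k → lookup ρ i Fin.< lookup ρ k → lookup ρ′ i Fin.< lookup ρ′ k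
  SameType₀⇒< {L} (sameType e) i k =
    ⌊⌋₂-≡⇒→ _ _ (funToFin-injective (funToFin-injective (orders-≡ L e) i) k)
    where
      orders-≡ : ∀ L → type L zero w ρ σ ≡ type L zero v ρ′ σ′ → orderTable w ρ ≡ orderTable v ρ′
      orders-≡ FO  e = combine-injectiveˡ _ _ _ _ e
      orders-≡ MSO e = combine-injectiveˡ _ _ _ _ (combine-injectiveˡ _ _ _ _ e)

  SameType₀⇒l : SameType L zero w ρ σ v ρ′ σ′ →
                ∀ i → letterAt w (lookup ρ i) ≡ l → letterAt v (lookup ρ′ i) ≡ l
  SameType₀⇒l {L} (sameType e) i = ⌊⌋₂-≡⇒→ _ _ (funToFin-injective (letters-≡ L e) i)
    where
      letters-≡ : ∀ L → type L zero w ρ σ ≡ type L zero v ρ′ σ′ → letterTable w ρ ≡ letterTable v ρ′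
      letters-≡ FO  e = combine-injectiveʳ (orderTable w ρ) _ (orderTable v ρ′) _ e
      letters-≡ MSO e =
        combine-injectiveʳ (orderTable w ρ) _ (orderTable v ρ′) _ (combine-injectiveˡ _ _ _ _ e)

  SameType₀⇒∈ : SameType MSO zero w ρ σ v ρ′ σ′ →
                ∀ X i → lookup ρ i ∈ lookup σ X → lookup ρ′ i ∈ lookup σ′ X
  SameType₀⇒∈ (sameType e) X i =
    ⌊⌋₂-≡⇒→ _ _ (funToFin-injective (funToFin-injective members-≡ X) i)
    where
      members-≡ : memberTable w ρ σ ≡ memberTable v ρ′ σ′
      members-≡ = combine-injectiveʳ (combine (orderTable w ρ) (letterTable w ρ)) _
                                     (combine (orderTable v ρ′) (letterTable v ρ′)) _ e

  SameType-extendPos : SameType L (suc j) w ρ σ v ρ′ σ′ →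
                       (p : Pos w) → ∃ λ p′ → SameType L j w (p ∷ ρ) σ v (p′ ∷ ρ′) σ′
  SameType-extendPos {FO}  (sameType e) p = map₂ sameType (image-≡⇒⊆ any? any? e p)
  SameType-extendPos {MSO} (sameType e) p =
    map₂ sameType (image-≡⇒⊆ any? any? (combine-injectiveˡ _ _ _ _ e) p)

  SameType-extendSet : SameType MSO (suc j) w ρ σ v ρ′ σ′ →
                       (X : Subset (len w)) → ∃ λ X′ → SameType MSO j w ρ (X ∷ σ) v ρ′ (X′ ∷ σ′)
  SameType-extendSet {j = j} (sameType e) X =
    map₂ sameType (image-≡⇒⊆ anySubset? anySubset? (combine-injectiveʳ wExtensions _ vExtensions _ e) X)
    where
      wExtensions vExtensions : Fin (2 ^ typeCount MSO j (suc n) m)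
      wExtensions = image any? λ p → type MSO j w (p ∷ ρ) σ
      vExtensions = image any? λ p → type MSO j v (p ∷ ρ′) σ′

-- A second block, since these lemmas apply the ones above with the two sides exchanged.
module _ {n m : ℕ} {w v : Word} {ρ : Vec (Pos w) n} {σ : Vec (Subset (len w)) m}
         {ρ′ : Vec (Pos v) n} {σ′ : Vec (Subset (len v)) m} where

  SameType₀⇒≡ : SameType L zero w ρ σ v ρ′ σ′ →
                ∀ i k → lookup ρ i ≡ lookup ρ k → lookup ρ′ i ≡ lookup ρ′ k
  SameType₀⇒≡ e i k ρi≡ρk with <ᶠ-cmp (lookup ρ′ i) (lookup ρ′ k)
  ... | tri< ρ′i<ρ′k _ _ = ⊥-elim (<ᶠ-irrefl ρi≡ρk (SameType₀⇒< (SameType-sym e) i k ρ′i<ρ′k))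
  ... | tri≈ _ ρ′i≡ρ′k _ = ρ′i≡ρ′k
  ... | tri> _ _ ρ′k<ρ′i = ⊥-elim (<ᶠ-irrefl (sym ρi≡ρk) (SameType₀⇒< (SameType-sym e) k i ρ′k<ρ′i))

  SameType₀⇒r : SameType L zero w ρ σ v ρ′ σ′ →
                ∀ i → letterAt w (lookup ρ i) ≡ r → letterAt v (lookup ρ′ i) ≡ r
  SameType₀⇒r e i wi≡r =
    ≢l⇒≡r λ vi≡l → l≢r (trans (sym (SameType₀⇒l (SameType-sym e) i vi≡l)) wi≡r)
    where l≢r : l ≢ r
          l≢r ()

SameType⇒Sat : {w v : Word} {ρ : Vec (Pos w) n} {σ : Vec (Subset (len w)) m}
               {ρ′ : Vec (Pos v) n} {σ′ : Vec (Subset (len v)) m} →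
               SameType L j w ρ σ v ρ′ σ′ →
               (φ : Form L n m) → qr φ ≤ j → Sat w φ ρ σ → Sat v φ ρ′ σ′
SameType⇒Sat {j = zero} e (lt i k)  _ = SameType₀⇒< e i k
SameType⇒Sat {j = zero} e (eq i k)  _ = SameType₀⇒≡ e i k
SameType⇒Sat {j = zero} e (Pl i)    _ = SameType₀⇒l e i
SameType⇒Sat {j = zero} e (Pr i)    _ = SameType₀⇒r e i
SameType⇒Sat {j = zero} e (mem X i) _ = SameType₀⇒∈ e X i
-- An atom has rank 0 ≤ j; it is read off a (j+1)-type through a dummy extra variable, which
-- exists because words are nonempty.
SameType⇒Sat {j = suc _} {w = w} e (lt i k) _ =
  SameType⇒Sat (proj₂ (SameType-extendPos e (firstPos w))) (lt (suc i) (suc k)) z≤n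
SameType⇒Sat {j = suc _} {w = w} e (eq i k) _ =
  SameType⇒Sat (proj₂ (SameType-extendPos e (firstPos w))) (eq (suc i) (suc k)) z≤n
SameType⇒Sat {j = suc _} {w = w} e (Pl i) _ =
  SameType⇒Sat (proj₂ (SameType-extendPos e (firstPos w))) (Pl (suc i)) z≤n
SameType⇒Sat {j = suc _} {w = w} e (Pr i) _ =
  SameType⇒Sat (proj₂ (SameType-extendPos e (firstPos w))) (Pr (suc i)) z≤n
SameType⇒Sat {j = suc _} {w = w} e (mem X i) _ =
  SameType⇒Sat (proj₂ (SameType-extendPos e (firstPos w))) (mem X (suc i)) z≤n
SameType⇒Sat e (neg φ) q ¬wφ vφ = ¬wφ (SameType⇒Sat (SameType-sym e) φ q vφ)
SameType⇒Sat e (and φ ψ) q (wφ , wψ) =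
  SameType⇒Sat e φ (m⊔n≤o⇒m≤o (qr φ) (qr ψ) q) wφ ,
  SameType⇒Sat e ψ (m⊔n≤o⇒n≤o (qr φ) (qr ψ) q) wψ
SameType⇒Sat e (or φ ψ) q (inj₁ wφ) = inj₁ (SameType⇒Sat e φ (m⊔n≤o⇒m≤o (qr φ) (qr ψ) q) wφ)
SameType⇒Sat e (or φ ψ) q (inj₂ wψ) = inj₂ (SameType⇒Sat e ψ (m⊔n≤o⇒n≤o (qr φ) (qr ψ) q) wψ)
SameType⇒Sat e (ex φ) (s≤s q) (p , wφ) =
  let p′ , e′ = SameType-extendPos e p in p′ , SameType⇒Sat e′ φ q wφ
SameType⇒Sat e (all φ) (s≤s q) wφ p′ =
  let p , e′ = SameType-extendPos (SameType-sym e) p′ in SameType⇒Sat (SameType-sym e′) φ q (wφ p)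
SameType⇒Sat e (ex₂ φ) (s≤s q) (X , wφ) =
  let X′ , e′ = SameType-extendSet e X in X′ , SameType⇒Sat e′ φ q wφ
SameType⇒Sat e (all₂ φ) (s≤s q) wφ X′ =
  let X , e′ = SameType-extendSet (SameType-sym e) X′ in SameType⇒Sat (SameType-sym e′) φ q (wφ X)

SameType⇒Equiv : ∀ L k (w v : Word) → SameType L k w [] [] v [] [] → Equiv L k w v
SameType⇒Equiv L k w v e φ q = mk⇔ (SameType⇒Sat e φ q) (SameType⇒Sat (SameType-sym e) φ q)

AllPairs-lookup : {R : A → A → Set} {xs : List A} → AllPairs R xs →
                  {i j : Fin (List.length xs)} → i Fin.< j → R (List.lookup xs i) (List.lookup xs j)
AllPairs-lookup (Rx ∷ _)    {zero}  {suc j} _         = All.lookup Rx (∈-lookup j)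
AllPairs-lookup (_ ∷ pairs) {suc i} {suc j} (s≤s i<j) = AllPairs-lookup pairs i<j

NumClasses≤-byInvariant : ∀ {c B} (f : Word → Fin c) → c ≤ B →
                          (∀ w v → f w ≡ f v → Equiv L k w v) → NumClasses≤ L k B
NumClasses≤-byInvariant {B = B} f c≤B f-≡⇒Equiv ws distinct with List.length ws ≤? B
... | yes |ws|≤B = |ws|≤B
... | no  |ws|≰B with pigeonhole (≤-<-trans c≤B (≰⇒> |ws|≰B)) (f ∘ List.lookup ws)
...   | i , j , i<j , fi≡fj = ⊥-elim (AllPairs-lookup distinct i<j (f-≡⇒Equiv _ _ fi≡fj))

NumClasses≤-byTypes : ∀ {B} → typeCount L k 0 0 ≤ B → NumClasses≤ L k B
NumClasses≤-byTypes {L} {k} bound =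
  NumClasses≤-byInvariant (λ w → type L k w [] []) bound
    (λ w v e → SameType⇒Equiv L k w v (sameType e))

n<2^n : ∀ n → n < 2 ^ n
n<2^n zero    = s≤s z≤n
n<2^n (suc n) = begin-strict
  suc n          <⟨ s≤s (n<2^n n) ⟩
  suc (2 ^ n)    ≤⟨ +-monoˡ-≤ (2 ^ n) (m^n>0 2 n) ⟩
  2 ^ n + 2 ^ n  ≡⟨ cong (2 ^ n +_) (+-identityʳ (2 ^ n)) ⟨
  2 ^ suc n      ∎
  where open ≤-Reasoning

n≤tower[n] : ∀ n → n ≤ tower n
n≤tower[n] zero    = z≤n
n≤tower[n] (suc n) = ≤-trans (s≤s (n≤tower[n] n)) (n<2^n (tower n))

≤tower-logStarFrom : ∀ x m fuel → x ≤ tower (m + fuel) → x ≤ tower (logStarFrom x m fuel)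
≤tower-logStarFrom x m zero x≤ = subst (λ t → x ≤ tower t) (+-identityʳ m) x≤
≤tower-logStarFrom x m (suc fuel) x≤ with x ≤ᵇ tower m in found
... | true  = ≤ᵇ⇒≤ x (tower m) (subst T (sym found) tt)
... | false = ≤tower-logStarFrom x (suc m) fuel (subst (λ t → x ≤ tower t) (+-suc m fuel) x≤)

≤tower-logStar : ∀ x → x ≤ tower (logStar x)
≤tower-logStar x = ≤tower-logStarFrom x 0 x (n≤tower[n] x)

[2^a]^b*2^c≡2^[a*b+c] : ∀ a b c → (2 ^ a) ^ b * 2 ^ c ≡ 2 ^ (a * b + c)
[2^a]^b*2^c≡2^[a*b+c] a b c = begin
  (2 ^ a) ^ b * 2 ^ c  ≡⟨ cong (_* 2 ^ c) (^-*-assoc 2 a b) ⟩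
  2 ^ (a * b) * 2 ^ c  ≡⟨ ^-distribˡ-+-* 2 (a * b) c ⟨
  2 ^ (a * b + c)      ∎
  where open ≡-Reasoning

typeCount-FO-zero : ∀ n m → typeCount FO zero n m ≡ 2 ^ (n * n + n)
typeCount-FO-zero n m = [2^a]^b*2^c≡2^[a*b+c] n n n

typeCount-MSO-zero : ∀ n m → typeCount MSO zero n m ≡ 2 ^ (n * n + n + n * m)
typeCount-MSO-zero n m = begin
  (2 ^ n) ^ n * 2 ^ n * (2 ^ n) ^ m  ≡⟨ cong (_* (2 ^ n) ^ m) ([2^a]^b*2^c≡2^[a*b+c] n n n) ⟩
  2 ^ (n * n + n) * (2 ^ n) ^ m      ≡⟨ *-comm (2 ^ (n * n + n)) ((2 ^ n) ^ m) ⟩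
  (2 ^ n) ^ m * 2 ^ (n * n + n)      ≡⟨ [2^a]^b*2^c≡2^[a*b+c] n m (n * n + n) ⟩
  2 ^ (n * m + (n * n + n))          ≡⟨ cong (2 ^_) (+-comm (n * m) (n * n + n)) ⟩
  2 ^ (n * n + n + n * m)            ∎
  where open ≡-Reasoning

typeCount-MSO-suc : ∀ j n m →
                    typeCount MSO (suc j) n m ≡ 2 ^ (typeCount MSO j (suc n) m + typeCount MSO j n (suc m))
typeCount-MSO-suc j n m = sym (^-distribˡ-+-* 2 (typeCount MSO j (suc n) m) (typeCount MSO j n (suc m)))

typeCount-MSO>0 : ∀ j n m → 0 < typeCount MSO j n m
typeCount-MSO>0 zero    n m = subst (0 <_) (sym (typeCount-MSO-zero n m)) (m^n>0 2 (n * n + n + n * m))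
typeCount-MSO>0 (suc j) n m = subst (0 <_) (sym (typeCount-MSO-suc j n m))
                                (m^n>0 2 (typeCount MSO j (suc n) m + typeCount MSO j n (suc m)))

typeCount-FO≤tower : ∀ {k T} → k * k + k ≤ tower T →
                     ∀ j n m → j + n ≤ k → typeCount FO j n m ≤ tower (j + T + 1)
typeCount-FO≤tower {k} {T} k²+k≤ zero n m n≤k = begin
  typeCount FO zero n m  ≡⟨ typeCount-FO-zero n m ⟩
  2 ^ (n * n + n)        ≤⟨ ^-monoʳ-≤ 2 (≤-trans (+-mono-≤ (*-mono-≤ n≤k n≤k) n≤k) k²+k≤) ⟩
  tower (1 + T)          ≡⟨ cong tower (+-comm 1 T) ⟩
  tower (T + 1)          ∎
  where open ≤-Reasoning
typeCount-FO≤tower k²+k≤ (suc j) n m 1+j+n≤k =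
  ^-monoʳ-≤ 2 (typeCount-FO≤tower k²+k≤ j (suc n) m (≤-trans (≤-reflexive (+-suc j n)) 1+j+n≤k))

2+[m+n]≤o : ∀ {m n o} → 0 < m → 0 < n → 4 * m ≤ o → 4 * n ≤ o → 2 + (m + n) ≤ o
2+[m+n]≤o {m} {n} {o} m>0 n>0 4m≤o 4n≤o = begin
  2 + (m + n)        ≡⟨ cong suc (+-suc m n) ⟨
  (1 + m) + (1 + n)  ≤⟨ +-mono-≤ (+-monoˡ-≤ m m>0) (+-monoˡ-≤ n n>0) ⟩
  (m + m) + (n + n)  ≤⟨ *-cancelˡ-≤ 2 double ⟩
  o                  ∎
  where
    open ≤-Reasoning
    regroup : ∀ m n → 2 * ((m + m) + (n + n)) ≡ 4 * m + 4 * n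
    regroup = solve-∀
    double : 2 * ((m + m) + (n + n)) ≤ 2 * o
    double = begin
      2 * ((m + m) + (n + n))  ≡⟨ regroup m n ⟩
      4 * m + 4 * n            ≤⟨ +-mono-≤ 4m≤o 4n≤o ⟩
      o + o                    ≡⟨ cong (o +_) (+-identityʳ o) ⟨
      2 * o                    ∎

4*2^n≡2^[2+n] : ∀ n → 4 * 2 ^ n ≡ 2 ^ (2 + n)
4*2^n≡2^[2+n] n = sym (^-distribˡ-+-* 2 2 n)

4*typeCount-MSO≤tower : ∀ {k T} → k * k + k + 2 ≤ tower T →
                        ∀ j n m → j + (n + m) ≤ k → 4 * typeCount MSO j n m ≤ tower (j + T + 1)
4*typeCount-MSO≤tower {k} {T} k²+k+2≤ zero n m n+m≤k = begin
  4 * typeCount MSO zero n m  ≡⟨ cong (4 *_) (typeCount-MSO-zero n m) ⟩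
  4 * 2 ^ E                   ≡⟨ 4*2^n≡2^[2+n] E ⟩
  2 ^ (2 + E)                 ≤⟨ ^-monoʳ-≤ 2 2+E≤ ⟩
  tower (1 + T)               ≡⟨ cong tower (+-comm 1 T) ⟩
  tower (T + 1)               ∎
  where
    open ≤-Reasoning
    E : ℕ
    E = n * n + n + n * m
    factor : ∀ n m → n * n + n + n * m ≡ n * (n + m) + n
    factor = solve-∀
    n≤k : n ≤ k
    n≤k = ≤-trans (m≤m+n n m) n+m≤k
    2+E≤ : 2 + E ≤ tower T
    2+E≤ = begin
      2 + E                  ≡⟨ +-comm 2 E ⟩
      E + 2                  ≡⟨ cong (_+ 2) (factor n m) ⟩
      n * (n + m) + n + 2    ≤⟨ +-monoˡ-≤ 2 (+-mono-≤ (*-mono-≤ n≤k n+m≤k) n≤k) ⟩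
      k * k + k + 2          ≤⟨ k²+k+2≤ ⟩
      tower T                ∎
4*typeCount-MSO≤tower {k} {T} k²+k+2≤ (suc j) n m 1+j+[n+m]≤k = begin
  4 * typeCount MSO (suc j) n m  ≡⟨ cong (4 *_) (typeCount-MSO-suc j n m) ⟩
  4 * 2 ^ (N₁ + N₂)              ≡⟨ 4*2^n≡2^[2+n] (N₁ + N₂) ⟩
  2 ^ (2 + (N₁ + N₂))            ≤⟨ ^-monoʳ-≤ 2 (2+[m+n]≤o N₁>0 N₂>0 4N₁≤ 4N₂≤) ⟩
  2 ^ tower (j + T + 1)          ∎
  where
    open ≤-Reasoning
    N₁ N₂ : ℕ
    N₁ = typeCount MSO j (suc n) m
    N₂ = typeCount MSO j n (suc m)
    N₁>0 : 0 < N₁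
    N₁>0 = typeCount-MSO>0 j (suc n) m
    N₂>0 : 0 < N₂
    N₂>0 = typeCount-MSO>0 j n (suc m)
    4N₁≤ : 4 * N₁ ≤ tower (j + T + 1)
    4N₁≤ = 4*typeCount-MSO≤tower k²+k+2≤ j (suc n) m
            (≤-trans (≤-reflexive (+-suc j (n + m))) 1+j+[n+m]≤k)
    4N₂≤ : 4 * N₂ ≤ tower (j + T + 1)
    4N₂≤ = 4*typeCount-MSO≤tower k²+k+2≤ j n (suc m)
            (≤-trans (≤-reflexive (trans (cong (j +_) (+-suc n m)) (+-suc j (n + m)))) 1+j+[n+m]≤k)

[1+k]²+[1+k]+2≤[2+k]² : ∀ k → suc k * suc k + suc k + 2 ≤ suc (suc k) * suc (suc k)
[1+k]²+[1+k]+2≤[2+k]² k = ≤-trans (m≤m+n _ k) (≤-reflexive (expand k))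
  where
    expand : ∀ k → suc k * suc k + suc k + 2 + k ≡ suc (suc k) * suc (suc k)
    expand = solve-∀

typeCount-FO≤ : ∀ k → typeCount FO k 0 0 ≤ tower (k + logStar (k * k + k) + 1)
typeCount-FO≤ k = typeCount-FO≤tower (≤tower-logStar (k * k + k)) k 0 0 (≤-reflexive (+-identityʳ k))

typeCount-MSO≤ : ∀ k → typeCount MSO k 0 0 ≤ tower (k + logStar (suc k * suc k) + 1)
typeCount-MSO≤ zero    = s≤s z≤n
typeCount-MSO≤ (suc k) = ≤-trans (m≤n*m (typeCount MSO (suc k) 0 0) 4)
  (4*typeCount-MSO≤tower (≤-trans ([1+k]²+[1+k]+2≤[2+k]² k) (≤tower-logStar (suc (suc k) * suc (suc k))))
                         (suc k) 0 0 (≤-reflexive (+-identityʳ (suc k))))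

theorem2 : (k : ℕ) →
    NumClasses≤ FO k (tower (k + logStar (k * k + k) + 1)) ×
    NumClasses≤ MSO k (tower (k + logStar (suc k * suc k) + 1))
theorem2 k = NumClasses≤-byTypes (typeCount-FO≤ k) , NumClasses≤-byTypes (typeCount-MSO≤ k)
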